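{- Let $X$ be a finite asymmetric graph and let $v$ be a vertex of $X$ such that the class $[v]=\{w\in V(X): \langle N(w,X)\rangle\cong\langle N(v,X)\rangle\}$ has odd cardinality. If $\langle N(v,X)\rangle$ does not have an automorphism that is a product of transpositions, then $X$ is not the induced neighbourhood of a finite vertex-transitive graph, i.e. there is no finite vertex-transitive graph $Y$ with $\langle N(y,Y)\rangle\cong X$ for the vertices $y$ of $Y$.
   Context: All graphs are simple. $N(v,X)$ is the set of neighbours of $v$ in $X$ and $\langle N(v,X)\rangle$ the induced subgraph on it. A graph is asymmetric if its only automorphism is the identity. An automorphism of a graph is called a product of transpositions if, as a permutation of the vertex set, it is a product of disjoint transpositions moving every vertex (a fixed-point-free involution; for the graph with no vertices, the identity). -}

module Defs where

open import Data.Nat using (ℕ; suc; _+_)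
open import Data.Fin using (Fin)
open import Data.Bool using (Bool; true; false)
open import Data.Product using (Σ; ∃; _×_; _,_; proj₁)
open import Relation.Binary.PropositionalEquality using (_≡_; _≢_)
open import Relation.Nullary using (¬_)
open import Function.Bundles using (_↔_; Inverse)
open import Function.Definitions using (Injective)

record Graph : Set₁ where
  field
    V      : Set
    adj    : V → V → Bool
    sym    : ∀ x y → adj x y ≡ adj y x
    irrefl : ∀ x → adj x x ≡ false
open Graph public

Finite : Graph → Set
Finite G = ∃ λ n → V G ↔ Fin n

Iso : Graph → Graph → Set
Iso G H = Σ (V G ↔ V H) λ f → ∀ x y → adj H (Inverse.to f x) (Inverse.to f y) ≡ adj G x y

Aut : Graph → Set
Aut G = Iso G G

perm : {G : Graph} → Aut G → V G → V G
perm σ = Inverse.to (proj₁ σ)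

Asymmetric : Graph → Set
Asymmetric G = (σ : Aut G) → ∀ x → perm {G} σ x ≡ x

-- An automorphism is a product of transpositions: a fixed-point-free involution
-- (vacuously true for the empty graph, where it is the identity).
ProductOfTranspositions : (G : Graph) → Aut G → Set
ProductOfTranspositions G σ = ∀ x → (perm {G} σ (perm {G} σ x) ≡ x) × (perm {G} σ x ≢ x)

VertexTransitive : Graph → Set
VertexTransitive G = ∀ x y → Σ (Aut G) λ σ → perm {G} σ x ≡ y

Nbhd : (G : Graph) → V G → Graph
Nbhd G v = record
  { V      = Σ (V G) λ w → adj G v w ≡ true
  ; adj    = λ a b → adj G (proj₁ a) (proj₁ b)
  ; sym    = λ a b → sym G (proj₁ a) (proj₁ b)
  ; irrefl = λ a → irrefl G (proj₁ a)
  }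

Odd : ℕ → Set
Odd m = ∃ λ k → m ≡ suc (k + k)

-- The class [v] = { w | <N(w,X)> ≅ <N(v,X)> } has odd cardinality:
-- it is enumerated without repetition by some Fin m with m odd.
OddClass : (X : Graph) → V X → Set
OddClass X v = ∃ λ m → Odd m × Σ (Fin m → V X) λ c →
  Injective _≡_ _≡_ c ×
  (∀ w → (Iso (Nbhd X w) (Nbhd X v) → ∃ λ i → c i ≡ w) ×
         ((∃ λ i → c i ≡ w) → Iso (Nbhd X w) (Nbhd X v)))

IsNbhdOfFiniteVT : Graph → Set₁
IsNbhdOfFiniteVT X = Σ Graph λ Y → Finite Y × VertexTransitive Y × V Y ×
  (∀ y → Iso (Nbhd Y y) X)

-- Fix y₀ in Y and label each edge y → x by the image of x under N(y,Y) ≅ X. As X is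
-- asymmetric, this isomorphism is unique, so every automorphism of Y preserves labels. Let
-- reverse w be the label of the edge back to y₀ from the neighbour of y₀ labelled w.
-- Vertex-transitivity makes reverse an involution of V(X), and N(X, reverse w) ≅ N(X, w), both
-- being the common neighbourhood of the two ends of that edge. Hence reverse permutes the odd
-- class [v] and fixes some w in it. An automorphism of Y moving the neighbour labelled w to y₀
-- then swaps the two ends, and acts on their common neighbourhood ≅ N(X, v) as a
-- fixed-point-free involution: fixing a vertex, it would fix all its neighbours, y₀ among them.
module Submission where

open import Defs hiding (sym)
open import Axiom.UniquenessOfIdentityProofs using (module Decidable⇒UIP)
open import Data.Bool using (true) renaming (_≟_ to _≟ᵇ_)
open import Data.Fin using () renaming (_≟_ to _≟ᶠ_)
open import Data.List using (List; []; _∷_; _++_; length; tabulate)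
open import Data.List.Membership.Propositional using (_∈_)
open import Data.List.Membership.Propositional.Properties
  using (∈-∃++; ∈-tabulate⁺; ∈-tabulate⁻)
open import Data.List.Properties using (length-tabulate)
open import Data.List.Relation.Binary.Permutation.Propositional using (_↭_; ↭-sym; ↭⇒↭ₛ)
open import Data.List.Relation.Binary.Permutation.Propositional.Properties
  using (shift; ∈-resp-↭; ↭-length)
import Data.List.Relation.Binary.Permutation.Setoid.Properties as Perm
import Data.List.Relation.Unary.All as All
open import Data.List.Relation.Unary.AllPairs using (_∷_)
open import Data.List.Relation.Unary.Any using (here; there)
open import Data.List.Relation.Unary.Unique.Propositional using (Unique)
open import Data.List.Relation.Unary.Unique.Propositional.Properties using (tabulate⁺)
open import Data.Nat using (zero; suc; _+_)
open import Data.Nat.Properties using (suc-injective; +-suc)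
open import Data.Product using (Σ; ∃; _×_; _,_; proj₁; proj₂)
open import Function.Base using (_∘_)
open import Function.Bundles using (_↔_; Inverse; Injection; mk↔ₛ′)
open import Function.Properties.Inverse using (↔-sym; ↔-trans; ↔⇒↣)
open import Relation.Binary.Definitions using (DecidableEquality)
open import Relation.Binary.PropositionalEquality
  using (_≡_; _≢_; refl; sym; trans; cong; cong₂; subst; setoid; module ≡-Reasoning)
open import Relation.Nullary using (¬_; yes; no; contradiction)
open import Relation.Nullary.Decidable using (via-injection)

private
  variable
    A : Set

module _ (_≟_ : DecidableEquality A) (f : A → A) (f-involutive : ∀ x → f (f x) ≡ x) where

  Closed : List A → Set
  Closed xs = ∀ {x} → x ∈ xs → f x ∈ xs

  ∈⇒↭∷ : ∀ {x : A} {xs} → x ∈ xs → ∃ λ rest → xs ↭ x ∷ rest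
  ∈⇒↭∷ x∈xs with ys , zs , refl ← ∈-∃++ x∈xs = ys ++ zs , shift _ ys zs

  remove-orbit : ∀ {x xs} → Unique (x ∷ xs) → Closed (x ∷ xs) → f x ∈ xs →
    ∃ λ rest → length xs ≡ suc (length rest) × Unique rest × Closed rest ×
               (∀ {y} → y ∈ rest → y ∈ xs)
  remove-orbit {x} {xs} (x≢xs ∷ xs!) closed fx∈xs
    with rest , xs↭ ← ∈⇒↭∷ fx∈xs
    with fx≢rest ∷ rest! ← Perm.Unique-resp-↭ (setoid A) (↭⇒↭ₛ xs↭) xs!
    = rest , ↭-length xs↭ , rest! , closed-rest , rest⊆xs
    where
    rest⊆xs : ∀ {y} → y ∈ rest → y ∈ xs
    rest⊆xs y∈rest = ∈-resp-↭ (↭-sym xs↭) (there y∈rest)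
    closed-rest : Closed rest
    closed-rest {y} y∈rest with closed (there (rest⊆xs y∈rest))
    ... | here fy≡x =
      contradiction (trans (sym (cong f fy≡x)) (f-involutive y)) (All.lookup fx≢rest y∈rest)
    ... | there fy∈xs with ∈-resp-↭ xs↭ fy∈xs
    ...   | here fy≡fx =
      contradiction (trans (sym (f-involutive x)) (trans (cong f (sym fy≡fx)) (f-involutive y)))
                    (All.lookup x≢xs (rest⊆xs y∈rest))
    ...   | there fy∈rest = fy∈rest

  involution-fixedPoint : ∀ k {xs} → length xs ≡ suc (k + k) → Unique xs → Closed xs →
    ∃ λ x → x ∈ xs × f x ≡ x
  involution-fixedPoint zero {x ∷ []} _ _ closed with closed (here refl)
  ... | here fx≡x = x , here refl , fx≡x
  involution-fixedPoint (suc k) {x ∷ xs} |x∷xs| x∷xs! closed with f x ≟ x | closed (here refl)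
  ... | yes fx≡x | _          = x , here refl , fx≡x
  ... | no fx≢x  | here fx≡x  = contradiction fx≡x fx≢x
  ... | no fx≢x  | there fx∈xs
    with rest , |xs| , rest! , closed-rest , rest⊆xs ← remove-orbit x∷xs! closed fx∈xs
    with y , y∈rest , fy≡y ← involution-fixedPoint k
           (suc-injective (trans (sym |xs|) (trans (suc-injective |x∷xs|) (cong suc (+-suc k k)))))
           rest! closed-rest
    = y , there (rest⊆xs y∈rest) , fy≡y

-- Stated for any Σ (A ↔ B) P rather than Iso G H because Agda cannot infer a Graph from Iso G H;
-- for the same reason the graphs are explicit arguments below.
module _ {A B : Set} {P : A ↔ B → Set} (f : Σ (A ↔ B) P) where

  to : A → B
  to = Inverse.to (proj₁ f)

  from : B → A
  from = Inverse.from (proj₁ f)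

  to-from : ∀ y → to (from y) ≡ y
  to-from = Inverse.strictlyInverseˡ (proj₁ f)

  from-to : ∀ x → from (to x) ≡ x
  from-to = Inverse.strictlyInverseʳ (proj₁ f)

  to-injective : ∀ {x x′} → to x ≡ to x′ → x ≡ x′
  to-injective = Injection.injective (↔⇒↣ (proj₁ f))

from-adj : (G H : Graph) (f : Iso G H) → ∀ x y → adj G (from f x) (from f y) ≡ adj H x y
from-adj G H f x y = begin
  adj G (from f x) (from f y)               ≡⟨ proj₂ f (from f x) (from f y) ⟨
  adj H (to f (from f x)) (to f (from f y)) ≡⟨ cong₂ (adj H) (to-from f x) (to-from f y) ⟩
  adj H x y                                 ∎
  where open ≡-Reasoning

Iso-sym : (G H : Graph) → Iso G H → Iso H G
Iso-sym G H f = ↔-sym (proj₁ f) , from-adj G H f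

Iso-trans : (G H K : Graph) → Iso G H → Iso H K → Iso G K
Iso-trans G H K f g =
  ↔-trans (proj₁ f) (proj₁ g) , λ x y → trans (proj₂ g (to f x) (to f y)) (proj₂ f x y)

adj-sym : (G : Graph) → ∀ {a b} → adj G a b ≡ true → adj G b a ≡ true
adj-sym G {a} {b} = trans (Graph.sym G b a)

adj⇒≢ : (G : Graph) → ∀ {a b} → adj G a b ≡ true → a ≢ b
adj⇒≢ G {a} p refl with () ← trans (sym (irrefl G a)) p

Nbhd-≡ : (G : Graph) → ∀ {a} {x y : V (Nbhd G a)} → proj₁ x ≡ proj₁ y → x ≡ y
Nbhd-≡ G {x = w , p} {y = .w , q} refl = cong (w ,_) (Decidable⇒UIP.≡-irrelevant _≟ᵇ_ p q)

Nbhd-Iso : (G H : Graph) (f : Iso G H) (a : V G) → Iso (Nbhd G a) (Nbhd H (to f a))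
Nbhd-Iso G H f a =
  mk↔ₛ′ to′ from′ (λ y → Nbhd-≡ H (to-from f (proj₁ y))) (λ x → Nbhd-≡ G (from-to f (proj₁ x))) ,
  λ x y → proj₂ f (proj₁ x) (proj₁ y)
  where
  to′ : V (Nbhd G a) → V (Nbhd H (to f a))
  to′ (x , p) = to f x , trans (proj₂ f a x) p
  from′ : V (Nbhd H (to f a)) → V (Nbhd G a)
  from′ (y , q) = from f y , (begin
    adj G a (from f y)                 ≡⟨ cong (λ z → adj G z (from f y)) (from-to f a) ⟨
    adj G (from f (to f a)) (from f y) ≡⟨ from-adj G H f (to f a) y ⟩
    adj H (to f a) y                   ≡⟨ q ⟩
    true                               ∎)
    where open ≡-Reasoning

Nbhd-Nbhd-swap : (G : Graph) {a b : V G} (p : adj G a b ≡ true) (q : adj G b a ≡ true) →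
  Iso (Nbhd (Nbhd G b) (a , q)) (Nbhd (Nbhd G a) (b , p))
Nbhd-Nbhd-swap G p q = mk↔ₛ′ swap swap (λ _ → refl) (λ _ → refl) , λ _ _ → refl
  where
  swap : ∀ {c d} → Σ (Σ (V G) λ x → adj G c x ≡ true) (λ x → adj G d (proj₁ x) ≡ true) →
                   Σ (Σ (V G) λ x → adj G d x ≡ true) (λ x → adj G c (proj₁ x) ≡ true)
  swap ((x , r) , s) = (x , s) , r

Asymmetric⇒Iso-unique : (G H : Graph) → Asymmetric H → (f g : Iso G H) → ∀ x → to f x ≡ to g x
Asymmetric⇒Iso-unique G H asym f g x = begin
  to f x                 ≡⟨ cong (to f) (from-to g x) ⟨
  to f (from g (to g x)) ≡⟨ asym (Iso-trans H G H (Iso-sym G H g) f) (to g x) ⟩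
  to g x                 ∎
  where open ≡-Reasoning

HasProductOfTranspositions : Graph → Set
HasProductOfTranspositions G = Σ (Aut G) (ProductOfTranspositions G)

involution⇒HasProductOfTranspositions : (G : Graph) (h : V G → V G) →
  (∀ x → h (h x) ≡ x) → (∀ x → h x ≢ x) → (∀ x y → adj G (h x) (h y) ≡ adj G x y) →
  HasProductOfTranspositions G
involution⇒HasProductOfTranspositions G h involutive fixed-point-free h-adj =
  (mk↔ₛ′ h h involutive involutive , h-adj) , λ x → involutive x , fixed-point-free x

HasProductOfTranspositions-resp-Iso : (G H : Graph) → Iso G H →
  HasProductOfTranspositions G → HasProductOfTranspositions H
HasProductOfTranspositions-resp-Iso G H f (σ , σ-pot) =
  involution⇒HasProductOfTranspositions H h involutive fixed-point-free (proj₂ conjugate)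
  where
  conjugate : Aut H
  conjugate = Iso-trans H G H (Iso-sym G H f) (Iso-trans G G H σ f)
  h : V H → V H
  h = perm {H} conjugate
  s : V G → V G
  s = perm {G} σ
  involutive : ∀ y → h (h y) ≡ y
  involutive y = begin
    to f (s (from f (to f (s (from f y))))) ≡⟨ cong (to f ∘ s) (from-to f _) ⟩
    to f (s (s (from f y)))                 ≡⟨ cong (to f) (proj₁ (σ-pot (from f y))) ⟩
    to f (from f y)                         ≡⟨ to-from f y ⟩
    y                                       ∎
    where open ≡-Reasoning
  fixed-point-free : ∀ y → h y ≢ y
  fixed-point-free y hy≡y =
    proj₂ (σ-pot (from f y)) (trans (sym (from-to f _)) (cong (from f) hy≡y))

module Labelling (X : Graph) (X-asym : Asymmetric X) (Y : Graph) (ℓ : ∀ y → Iso (Nbhd Y y) X) where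

  label : (y x : V Y) → adj Y y x ≡ true → V X
  label y x p = to (ℓ y) (x , p)

  label-cong : ∀ {y y′ x x′} (p : adj Y y x ≡ true) (p′ : adj Y y′ x′ ≡ true) →
    y ≡ y′ → x ≡ x′ → label y x p ≡ label y′ x′ p′
  label-cong {y} p p′ refl refl = cong (to (ℓ y)) (Nbhd-≡ Y refl)

  label-injective : ∀ {y x x′} (p : adj Y y x ≡ true) (p′ : adj Y y x′ ≡ true) →
    label y x p ≡ label y x′ p′ → x ≡ x′
  label-injective {y} p p′ e = cong proj₁ (to-injective (ℓ y) e)

  label-Aut-invariant : (g : Aut Y) →
    ∀ {y x y′ x′} (p : adj Y y x ≡ true) (p′ : adj Y y′ x′ ≡ true) →
    perm {Y} g y ≡ y′ → perm {Y} g x ≡ x′ → label y′ x′ p′ ≡ label y x p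
  label-Aut-invariant g {y} {x} p p′ refl refl =
    trans (label-cong p′ _ refl refl) (Asymmetric⇒Iso-unique (Nbhd Y y) X X-asym ℓ′ (ℓ y) (x , p))
    where
    ℓ′ : Iso (Nbhd Y y) X
    ℓ′ = Iso-trans (Nbhd Y y) (Nbhd Y (perm {Y} g y)) X (Nbhd-Iso Y Y g y) (ℓ (perm {Y} g y))

  Aut-swap⇒HasProductOfTranspositions : (g : Aut Y) → ∀ {a b} (p : adj Y a b ≡ true) →
    perm {Y} g a ≡ b → perm {Y} g b ≡ a → HasProductOfTranspositions (Nbhd (Nbhd Y a) (b , p))
  Aut-swap⇒HasProductOfTranspositions g {a} {b} p γa≡b γb≡a =
    involution⇒HasProductOfTranspositions (Nbhd (Nbhd Y a) (b , p)) h involutive fixed-point-free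
      (λ x y → proj₂ g (proj₁ (proj₁ x)) (proj₁ (proj₁ y)))
    where
    γ : V Y → V Y
    γ = perm {Y} g
    γ-adj : ∀ {u u′ x} → γ u ≡ u′ → adj Y u x ≡ true → adj Y u′ (γ x) ≡ true
    γ-adj {u} {x = x} refl ux = trans (proj₂ g u x) ux
    h : V (Nbhd (Nbhd Y a) (b , p)) → V (Nbhd (Nbhd Y a) (b , p))
    h ((x , ax) , bx) = (γ x , γ-adj γb≡a bx) , γ-adj γa≡b ax
    involutive : ∀ x → h (h x) ≡ x
    involutive ((x , ax) , _) = Nbhd-≡ (Nbhd Y a) {b , p} (Nbhd-≡ Y {a} γγx≡x)
      where
      bγx = γ-adj γa≡b ax
      aγγx = γ-adj γb≡a bγx
      γγx≡x : γ (γ x) ≡ x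
      γγx≡x = label-injective aγγx ax
        (trans (label-Aut-invariant g bγx aγγx γb≡a refl) (label-Aut-invariant g ax bγx γa≡b refl))
    fixed-point-free : ∀ x → h x ≢ x
    fixed-point-free ((x , ax) , _) hx≡x = adj⇒≢ Y p (sym (trans (sym γa≡b) γa≡a))
      where
      γx≡x : γ x ≡ x
      γx≡x = cong (proj₁ ∘ proj₁) hx≡x
      xa = adj-sym Y ax
      xγa = γ-adj γx≡x xa
      γa≡a : γ a ≡ a
      γa≡a = label-injective xγa xa (label-Aut-invariant g xa xγa γx≡x refl)

  module Rooted (Y-vt : VertexTransitive Y) (y₀ : V Y) where

    nb : V X → V Y
    nb w = proj₁ (from (ℓ y₀) w)

    y₀-nb : ∀ w → adj Y y₀ (nb w) ≡ true
    y₀-nb w = proj₂ (from (ℓ y₀) w)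

    reverse : V X → V X
    reverse w = label (nb w) y₀ (adj-sym Y (y₀-nb w))

    perm-nb≡y₀⇒perm-y₀≡nb-reverse : ∀ w (g : Aut Y) →
      perm {Y} g (nb w) ≡ y₀ → perm {Y} g y₀ ≡ nb (reverse w)
    perm-nb≡y₀⇒perm-y₀≡nb-reverse w g γnb≡y₀ = label-injective y₀γy₀ (y₀-nb (reverse w)) (begin
      label y₀ (perm {Y} g y₀) y₀γy₀
        ≡⟨ label-Aut-invariant g (adj-sym Y (y₀-nb w)) y₀γy₀ γnb≡y₀ refl ⟩
      reverse w
        ≡⟨ to-from (ℓ y₀) (reverse w) ⟨
      label y₀ (nb (reverse w)) (y₀-nb (reverse w))
        ∎)
      where
      open ≡-Reasoning
      y₀γy₀ : adj Y y₀ (perm {Y} g y₀) ≡ true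
      y₀γy₀ = trans (cong (λ z → adj Y z (perm {Y} g y₀)) (sym γnb≡y₀))
                    (trans (proj₂ g (nb w) y₀) (adj-sym Y (y₀-nb w)))

    reverse-involutive : ∀ w → reverse (reverse w) ≡ w
    reverse-involutive w = begin
      reverse (reverse w)
        ≡⟨ label-Aut-invariant g (y₀-nb w) _ (perm-nb≡y₀⇒perm-y₀≡nb-reverse w g γnb≡y₀) γnb≡y₀ ⟩
      label y₀ (nb w) (y₀-nb w)
        ≡⟨ to-from (ℓ y₀) w ⟩
      w ∎
      where
      open ≡-Reasoning
      g = proj₁ (Y-vt (nb w) y₀)
      γnb≡y₀ = proj₂ (Y-vt (nb w) y₀)

    Nbhd-nb-Iso : ∀ w → Iso (Nbhd X w) (Nbhd (Nbhd Y y₀) (nb w , y₀-nb w))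
    Nbhd-nb-Iso = Nbhd-Iso X (Nbhd Y y₀) (Iso-sym (Nbhd Y y₀) X (ℓ y₀))

    reverse-Nbhd-Iso : ∀ w → Iso (Nbhd X (reverse w)) (Nbhd X w)
    reverse-Nbhd-Iso w =
      Iso-trans (Nbhd X (reverse w)) N-nb-y₀ (Nbhd X w)
        (Iso-sym N-nb-y₀ (Nbhd X (reverse w)) (Nbhd-Iso (Nbhd Y (nb w)) X (ℓ (nb w)) (y₀ , nb-y₀)))
        (Iso-trans N-nb-y₀ N-y₀-nb (Nbhd X w) (Nbhd-Nbhd-swap Y (y₀-nb w) nb-y₀)
          (Iso-sym (Nbhd X w) N-y₀-nb (Nbhd-nb-Iso w)))
      where
      nb-y₀ = adj-sym Y (y₀-nb w)
      N-y₀-nb = Nbhd (Nbhd Y y₀) (nb w , y₀-nb w)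
      N-nb-y₀ = Nbhd (Nbhd Y (nb w)) (y₀ , nb-y₀)

    reverse-fixed⇒HasProductOfTranspositions : ∀ w → reverse w ≡ w →
      HasProductOfTranspositions (Nbhd X w)
    reverse-fixed⇒HasProductOfTranspositions w reverse-w≡w =
      HasProductOfTranspositions-resp-Iso N-y₀-nb (Nbhd X w)
        (Iso-sym (Nbhd X w) N-y₀-nb (Nbhd-nb-Iso w))
        (Aut-swap⇒HasProductOfTranspositions g (y₀-nb w) γy₀≡nb γnb≡y₀)
      where
      N-y₀-nb = Nbhd (Nbhd Y y₀) (nb w , y₀-nb w)
      g = proj₁ (Y-vt (nb w) y₀)
      γnb≡y₀ = proj₂ (Y-vt (nb w) y₀)
      γy₀≡nb = trans (perm-nb≡y₀⇒perm-y₀≡nb-reverse w g γnb≡y₀) (cong nb reverse-w≡w)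

OddClass⇒fixedPoint : (X : Graph) (v : V X) → DecidableEquality (V X) → OddClass X v →
  (τ : V X → V X) → (∀ w → τ (τ w) ≡ w) → (∀ w → Iso (Nbhd X (τ w)) (Nbhd X w)) →
  ∃ λ w → Iso (Nbhd X w) (Nbhd X v) × τ w ≡ w
OddClass⇒fixedPoint X v _≟_ (_ , (k , m≡) , c , c-injective , c-class) τ τ-involutive τ-Iso =
  let w , w∈ , τw≡w = involution-fixedPoint _≟_ τ τ-involutive k
                        (trans (length-tabulate c) m≡) (tabulate⁺ c-injective) τ-closed
  in w , member-Iso w∈ , τw≡w
  where
  member-Iso : ∀ {w} → w ∈ tabulate c → Iso (Nbhd X w) (Nbhd X v)
  member-Iso w∈ with i , refl ← ∈-tabulate⁻ w∈ = proj₂ (c-class (c i)) (i , refl)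
  τ-closed : ∀ {w} → w ∈ tabulate c → τ w ∈ tabulate c
  τ-closed {w} w∈
    with i , ci≡τw ← proj₁ (c-class (τ w))
                       (Iso-trans (Nbhd X (τ w)) (Nbhd X w) (Nbhd X v) (τ-Iso w) (member-Iso w∈))
    = subst (_∈ tabulate c) ci≡τw (∈-tabulate⁺ i)

theorem2p3 : (X : Graph) → Finite X → Asymmetric X → (v : V X) → OddClass X v →
    ¬ (Σ (Aut (Nbhd X v)) λ σ → ProductOfTranspositions (Nbhd X v) σ) →
    ¬ IsNbhdOfFiniteVT X
theorem2p3 X (_ , X↔Fin) X-asym v v-class no-PoT (Y , _ , Y-vt , y₀ , ℓ) =
  let w , w≅v , reverse-w≡w = OddClass⇒fixedPoint X v (via-injection (↔⇒↣ X↔Fin) _≟ᶠ_) v-class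
                                reverse reverse-involutive reverse-Nbhd-Iso
  in no-PoT (HasProductOfTranspositions-resp-Iso (Nbhd X w) (Nbhd X v) w≅v
              (reverse-fixed⇒HasProductOfTranspositions w reverse-w≡w))
  where
  open Labelling X X-asym Y ℓ
  open Rooted Y-vt y₀
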